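{- Let $f:[1\,.\,.\,n]\to\{0,1\}$, let $S=\{i\in[1\,.\,.\,n]: f(i)=1\}$, and define $s(f(i),i)=0$ if $f(i)=0$ and $s(f(i),i)=i$ if $f(i)=1$. Let $X$ be the string of length $4n+2$ over the alphabet $\{0,\$\}\cup[1\,.\,.\,n]$ given by \[X = 0^{2n}\,\$\,\Big(\textstyle\prod_{i=1}^{n} 0\; s(f(i),i)\Big)\,0,\] where the product denotes concatenation in increasing order of $i$. Then the LZ77 factorization of $X$ has $z = 2|S| + 4$ factors.
   Context: LZ77 factorization: greedy left-to-right parsing where each phrase starting at position $p$ is the longest fragment $X[p\,.\,.\,p+\ell)$ equal to $X[p'\,.\,.\,p'+\ell)$ for some $p'<p$ (overlaps allowed), or the single character $X[p]$ if no such nonempty fragment exists; $z$ is the number of phrases. The symbols $0$, $\$$, and $1,\dots,n$ are pairwise distinct.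
   Formalization: The set S is assumed nonempty, that is, f(i) = 1 for at least one i ∈ [1..n]. The statement above fails without it. -}

module Defs where

open import Data.Nat using (ℕ; zero; suc; _+_; _*_; _<_; _≤_)
open import Data.Bool using (Bool; true; false; T)
open import Data.Fin using (Fin; toℕ)
open import Data.List using (List; []; _∷_; _++_; length; replicate; concatMap; filter; allFin)
open import Data.Maybe using (Maybe; just; nothing)
open import Data.Product using (Σ; ∃; _×_; _,_)
open import Data.Sum using (_⊎_)
open import Relation.Nullary using (¬_)
open import Relation.Binary.PropositionalEquality using (_≡_)
open import Data.Bool.Properties using (T?)

data Sym : Set where
  zer    : Sym
  dollar : Sym
  num    : ℕ → Sym        -- the symbol i (used for i ∈ [1 .. n])

-- X[i] (0-based), nothing if out of range
_at_ : {A : Set} → List A → ℕ → Maybe A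
[] at _ = nothing
(x ∷ xs) at zero = just x
(x ∷ xs) at suc i = xs at i

-- X[p .. p+ℓ) equals X[p' .. p'+ℓ) for some p' < p (overlaps allowed),
-- and the fragment X[p .. p+ℓ) lies inside X
OccursEarlier : {A : Set} → List A → ℕ → ℕ → Set
OccursEarlier X p ℓ =
  p + ℓ ≤ length X ×
  ∃ λ p' → p' < p × (∀ k → k < ℓ → X at (p' + k) ≡ X at (p + k))

PhraseLen : {A : Set} → List A → ℕ → ℕ → Set
PhraseLen X p ℓ =
  p < length X ×
  ((1 ≤ ℓ × OccursEarlier X p ℓ × (∀ m → OccursEarlier X p m → m ≤ ℓ))
   ⊎ (ℓ ≡ 1 × ¬ OccursEarlier X p 1))

-- LZ77 X p z : the greedy LZ77 parsing of the suffix starting at position p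
-- consists of exactly z phrases.
data LZ77 {A : Set} (X : List A) : ℕ → ℕ → Set where
  done : LZ77 X (length X) 0
  step : ∀ {p ℓ z} → PhraseLen X p ℓ → LZ77 X (p + ℓ) z → LZ77 X p (suc z)

LZ77Size : {A : Set} → List A → ℕ → Set
LZ77Size X z = LZ77 X 0 z

-- s(f(i), i) for i ∈ [1..n], where Fin n index j represents i = j + 1
sSym : Bool → ℕ → Sym
sSym false i = zer
sSym true  i = num i

buildX : (n : ℕ) → (Fin n → Bool) → List Sym
buildX n f =
  replicate (2 * n) zer ++ (dollar ∷
    (concatMap (λ j → zer ∷ sSym (f j) (suc (toℕ j)) ∷ []) (allFin n) ++ (zer ∷ [])))

S : (n : ℕ) → (Fin n → Bool) → List (Fin n)
S n f = filter (λ j → T? (f j)) (allFin n)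

{-# OPTIONS --safe #-}
module Submission where

-- The greedy parse is forced.  0 is new, 0^{2n-1} is copied from position 0 (overlapping itself)
-- and $ is new.  After $ every run of 0s is shorter than 2n because some f(i) = 1, so it is copied
-- from the prefix 0^{2n}; it cannot be extended, since it is followed either by a symbol i, which
-- occurs only once in X, or by the end of X.  Each i ∈ S is then a new one-symbol phrase, giving
-- 3 + 2|S| + 1 phrases.

open import Defs
open import Data.Nat using (ℕ; zero; suc; _+_; _*_; _<_; _≤_; z≤n; s≤s)
open import Data.Nat.Properties
open import Data.Bool using (Bool; true; false)
open import Data.Fin using (Fin; toℕ) renaming (zero to fzero; suc to fsuc)
open import Data.List using (List; []; _∷_; _++_; length; replicate; drop; concatMap; filter; tabulate; allFin)
open import Data.List.Properties using (length-replicate; length-tabulate; drop-drop; ++-identityʳ)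
open import Data.List.Relation.Unary.Any as Any using (Any; here; there)
open import Data.List.Membership.Propositional.Properties using (∈-allFin)
open import Data.Maybe using (just; nothing)
open import Data.Maybe.Properties using (just-injective)
open import Data.Product using (∃; _×_; _,_; proj₁; proj₂)
open import Data.Sum using (_⊎_; inj₁; inj₂)
open import Relation.Nullary using (contradiction)
open import Relation.Nullary.Decidable using (T?)
open import Relation.Binary.PropositionalEquality

m+2*[1+n]≡2+[m+2*n] : ∀ m n → m + 2 * suc n ≡ suc (suc (m + 2 * n))
m+2*[1+n]≡2+[m+2*n] m n = begin
  m + 2 * suc n         ≡⟨ cong (m +_) (*-suc 2 n) ⟩
  m + suc (suc (2 * n)) ≡⟨ +-suc m _ ⟩
  suc (m + suc (2 * n)) ≡⟨ cong suc (+-suc m _) ⟩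
  suc (suc (m + 2 * n)) ∎
  where open ≡-Reasoning

module _ {A : Set} where

  at-drop : ∀ p (X : List A) k → X at (p + k) ≡ drop p X at k
  at-drop zero    X       k = refl
  at-drop (suc p) []      k = refl
  at-drop (suc p) (x ∷ X) k = at-drop p X k

  at⇒< : ∀ (X : List A) {q y} → X at q ≡ just y → q < length X
  at⇒< (x ∷ X) {zero}  _  = s≤s z≤n
  at⇒< (x ∷ X) {suc q} eq = s≤s (at⇒< X eq)

  at-length : (X : List A) → X at length X ≡ nothing
  at-length []      = refl
  at-length (x ∷ X) = at-length X

  at-replicate-++ : ∀ {m k} (x : A) Y → k < m → (replicate m x ++ Y) at k ≡ just x
  at-replicate-++ {suc m} {zero}  x Y _         = refl
  at-replicate-++ {suc m} {suc k} x Y (s≤s k<m) = at-replicate-++ x Y k<m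

  at-replicate⁻ : ∀ m {x y : A} q → replicate m x at q ≡ just y → x ≡ y
  at-replicate⁻ (suc m) zero    eq = just-injective eq
  at-replicate⁻ (suc m) (suc q) eq = at-replicate⁻ m q eq

  at-++⁻ : ∀ (P : List A) {Y q y} → (P ++ Y) at q ≡ just y →
           P at q ≡ just y ⊎ ∃ λ k → q ≡ length P + k × Y at k ≡ just y
  at-++⁻ []      {q = q}     eq = inj₂ (q , refl , eq)
  at-++⁻ (x ∷ P) {q = zero}  eq = inj₁ eq
  at-++⁻ (x ∷ P) {q = suc q} eq with at-++⁻ P eq
  ... | inj₁ inP              = inj₁ inP
  ... | inj₂ (k , refl , inY) = inj₂ (k , refl , inY)

  replicate-++-∷ : ∀ m (x : A) Y → replicate m x ++ x ∷ Y ≡ replicate (suc m) x ++ Y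
  replicate-++-∷ zero    x Y = refl
  replicate-++-∷ (suc m) x Y = cong (x ∷_) (replicate-++-∷ m x Y)

  drop-replicate-++ : ∀ m {x : A} Y → drop m (replicate m x ++ Y) ≡ Y
  drop-replicate-++ zero    Y = refl
  drop-replicate-++ (suc m) Y = drop-replicate-++ m Y

  drop≡∷⇒at : ∀ p (X : List A) {y Y} → drop p X ≡ y ∷ Y → X at p ≡ just y
  drop≡∷⇒at zero    X       refl = refl
  drop≡∷⇒at (suc p) []      ()
  drop≡∷⇒at (suc p) (x ∷ X) eq   = drop≡∷⇒at p X eq

  drop≡∷⇒length : ∀ p (X : List A) {y Y} → drop p X ≡ y ∷ Y → length X ≡ p + length (y ∷ Y)
  drop≡∷⇒length zero    X       refl = refl
  drop≡∷⇒length (suc p) []      ()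
  drop≡∷⇒length (suc p) (x ∷ X) eq   = cong suc (drop≡∷⇒length p X eq)

  drop-∷ : ∀ p (X : List A) {y Y} → drop p X ≡ y ∷ Y → drop (p + 1) X ≡ Y
  drop-∷ p X eq = trans (sym (drop-drop p 1 X)) (cong (drop 1) eq)

  drop-replicate : ∀ p (X : List A) m {x Y} → drop p X ≡ replicate m x ++ Y → drop (p + m) X ≡ Y
  drop-replicate p X m {Y = Y} eq =
    trans (sym (drop-drop p m X)) (trans (cong (drop m) eq) (drop-replicate-++ m Y))

  -- The symbol at q has no earlier occurrence; q = length X counts, its "symbol" being nothing.
  Fresh : List A → ℕ → Set
  Fresh X q = ∀ p → p < q → X at p ≢ X at q

  fresh-end : (X : List A) → Fresh X (length X)
  fresh-end (x ∷ X) zero    _         same = contradiction (trans same (at-length X)) λ ()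
  fresh-end (x ∷ X) (suc p) (s≤s p<n) same = fresh-end X p p<n same

  fresh⇒phraseLen : ∀ (X : List A) {q} → q < length X → Fresh X q → PhraseLen X q 1
  fresh⇒phraseLen X {q} q<∣X∣ fresh = q<∣X∣ , inj₂ (refl , λ (_ , p , p<q , same) →
    fresh p p<q (subst₂ (λ a b → X at a ≡ X at b) (+-identityʳ p) (+-identityʳ q) (same 0 (s≤s z≤n))))

  unextendable⇒phraseLen : ∀ (X : List A) {p ℓ} → 0 < ℓ → OccursEarlier X p ℓ →
                           Fresh X (p + ℓ) → PhraseLen X p ℓ
  unextendable⇒phraseLen X {p} {ℓ} 0<ℓ occ@(p+ℓ≤∣X∣ , _) fresh =
    <-≤-trans (m<m+n p 0<ℓ) p+ℓ≤∣X∣ , inj₁ (0<ℓ , occ , longest)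
    where
    longest : ∀ m → OccursEarlier X p m → m ≤ ℓ
    longest m (_ , p′ , p′<p , same) = ≮⇒≥ λ ℓ<m → fresh (p′ + ℓ) (+-monoˡ-< ℓ p′<p) (same ℓ ℓ<m)

  module _ (X : List A) {x : A} {N : ℕ} (prefix : ∀ k → k < N → X at k ≡ just x) where

    run⇒phraseLen : ∀ {p ℓ Y} → 0 < p → 0 < ℓ → ℓ ≤ N → drop p X ≡ replicate ℓ x ++ Y →
                    Fresh X (p + ℓ) → PhraseLen X p ℓ
    run⇒phraseLen {p} {suc c} {Y} 0<p 0<ℓ ℓ≤N eq =
      unextendable⇒phraseLen X 0<ℓ (p+ℓ≤∣X∣ , 0 , 0<p , copy)
      where
      inRun : ∀ {k} → k < suc c → X at (p + k) ≡ just x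
      inRun k<ℓ = trans (at-drop p X _) (trans (cong (_at _) eq) (at-replicate-++ x Y k<ℓ))
      p+ℓ≤∣X∣ : p + suc c ≤ length X
      p+ℓ≤∣X∣ = subst (_≤ length X) (sym (+-suc p c)) (at⇒< X (inRun (n<1+n c)))
      copy : ∀ k → k < suc c → X at (0 + k) ≡ X at (p + k)
      copy k k<ℓ = trans (prefix k (<-≤-trans k<ℓ ℓ≤N)) (sym (inRun k<ℓ))

    lastRun⇒LZ77 : ∀ {p ℓ} → 0 < p → 0 < ℓ → ℓ ≤ N → drop p X ≡ replicate ℓ x → LZ77 X p 1
    lastRun⇒LZ77 {p} {suc c} 0<p 0<ℓ ℓ≤N eq =
      step (run⇒phraseLen 0<p 0<ℓ ℓ≤N (trans eq (sym (++-identityʳ _))) (subst (Fresh X) end (fresh-end X)))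
           (subst (λ q → LZ77 X q 0) end done)
      where
      end : length X ≡ p + suc c
      end = trans (drop≡∷⇒length p X eq) (cong (λ t → p + suc t) (length-replicate c))

cell : ∀ {n} → (Fin n → Bool) → Fin n → List Sym
cell f j = zer ∷ sSym (f j) (suc (toℕ j)) ∷ []

sSym-num : ∀ b {i j} → sSym b i ≡ num j → i ≡ j
sSym-num true refl = refl

cells-num-position : ∀ {n m} (f : Fin n → Bool) (h : Fin m → Fin n) o →
  (∀ j → toℕ (h j) ≡ toℕ j + o) →
  ∀ k {i} → (concatMap (cell f) (tabulate h) ++ zer ∷ []) at k ≡ just (num i) → suc k + 2 * o ≡ 2 * i
cells-num-position {m = zero}  f h o e zero          ()
cells-num-position {m = zero}  f h o e (suc k)       ()
cells-num-position {m = suc m} f h o e zero          ()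
cells-num-position {m = suc m} f h o e (suc zero)    eq =
  trans (sym (*-suc 2 o)) (cong (2 *_) (trans (cong suc (sym (e fzero))) (sSym-num _ (just-injective eq))))
cells-num-position {m = suc m} f h o e (suc (suc k)) eq =
  trans (sym (m+2*[1+n]≡2+[m+2*n] (suc k) o))
        (cells-num-position f (λ j → h (fsuc j)) (suc o) (λ j → trans (e (fsuc j)) (sym (+-suc (toℕ j) o))) k eq)

module BuildX (n : ℕ) (f : Fin n → Bool) where

  X : List Sym
  X = buildX n f

  zeros-prefix : ∀ k → k < 2 * n → X at k ≡ just zer
  zeros-prefix k = at-replicate-++ zer _

  drop-prefix : drop (2 * n) X ≡ dollar ∷ concatMap (cell f) (allFin n) ++ zer ∷ []
  drop-prefix = drop-replicate 0 X (2 * n) refl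

  at-dollar : X at (2 * n) ≡ just dollar
  at-dollar = drop≡∷⇒at (2 * n) X drop-prefix

  dollar-fresh : Fresh X (2 * n)
  dollar-fresh p p<2n same = contradiction (trans (sym (zeros-prefix p p<2n)) (trans same at-dollar)) λ ()

  num-position : ∀ {q i} → X at q ≡ just (num i) → q ≡ 2 * n + 2 * i
  num-position eq with at-++⁻ (replicate (2 * n) zer) eq
  ... | inj₁ inPrefix              = contradiction (at-replicate⁻ (2 * n) _ inPrefix) λ ()
  ... | inj₂ (zero , _ , ())
  ... | inj₂ (suc k , refl , inBody) =
    cong₂ _+_ (length-replicate (2 * n))
      (trans (sym (+-identityʳ (suc k))) (cells-num-position f (λ j → j) 0 (λ j → sym (+-identityʳ _)) k inBody))

  num-fresh : ∀ {q i} → X at q ≡ just (num i) → Fresh X q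
  num-fresh eq p p<q same = <-irrefl (trans (num-position (trans same eq)) (sym (num-position eq))) p<q

  -- c zeros of the current run have already been read before js.
  RunsAtMost : ℕ → ℕ → List (Fin n) → Set
  RunsAtMost N c []       = suc c ≤ N
  RunsAtMost N c (j ∷ js) with f j
  ... | true  = suc c ≤ N × RunsAtMost N 0 js
  ... | false = RunsAtMost N (suc (suc c)) js

  mutual
    runsAtMost-short : ∀ {N} c js → c + 2 * length js < N → RunsAtMost N c js
    runsAtMost-short {N} c [] c<N = subst (λ t → suc t ≤ N) (+-identityʳ c) c<N
    runsAtMost-short {N} c (j ∷ js) bound with f j
    ... | true  = runsAtMost-closed c js (<⇒≤ bound)
    ... | false = runsAtMost-short (suc (suc c)) js (subst (_< N) (m+2*[1+n]≡2+[m+2*n] c (length js)) bound)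

    runsAtMost-closed : ∀ {N} c js → c + 2 * suc (length js) ≤ N → suc c ≤ N × RunsAtMost N 0 js
    runsAtMost-closed {N} c js bound =
      ≤-trans (s≤s (m≤m+n c _)) (≤-trans (n≤1+n _) bound′) ,
      runsAtMost-short 0 js (≤-trans (s≤s (m≤n+m _ c)) (≤-trans (n≤1+n _) bound′))
      where
      bound′ : suc (suc (c + 2 * length js)) ≤ N
      bound′ = subst (_≤ N) (m+2*[1+n]≡2+[m+2*n] c (length js)) bound

  runsAtMost-any : ∀ {N} c js → Any (λ j → f j ≡ true) js → c + 2 * length js ≤ N → RunsAtMost N c js
  runsAtMost-any c (j ∷ js) (here fj) bound rewrite fj = runsAtMost-closed c js bound
  runsAtMost-any {N} c (j ∷ js) (there one) bound with f j
  ... | true  = runsAtMost-closed c js bound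
  ... | false = runsAtMost-any (suc (suc c)) js one (subst (_≤ N) (m+2*[1+n]≡2+[m+2*n] c (length js)) bound)

  cells⇒LZ77 : ∀ js {p c} → 0 < p → drop p X ≡ replicate c zer ++ concatMap (cell f) js ++ zer ∷ [] →
    RunsAtMost (2 * n) c js → LZ77 X p (suc (2 * length (filter (λ j → T? (f j)) js)))
  cells⇒LZ77 [] {p} {c} 0<p eq fits =
    lastRun⇒LZ77 X zeros-prefix 0<p (s≤s z≤n) fits (trans eq (trans (replicate-++-∷ c zer []) (++-identityʳ _)))
  cells⇒LZ77 (j ∷ js) {p} {c} 0<p eq fits with f j
  ... | false = cells⇒LZ77 js 0<p (trans eq (trans (replicate-++-∷ c zer _) (replicate-++-∷ (suc c) zer _))) fits
  ... | true  = subst (LZ77 X p) (cong suc (sym (*-suc 2 _)))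
    (step (run⇒phraseLen X zeros-prefix 0<p (s≤s z≤n) (proj₁ fits) run (num-fresh at-num))
    (step (fresh⇒phraseLen X (at⇒< X at-num) (num-fresh at-num))
    (cells⇒LZ77 js (m≤n+m 1 (p + suc c)) (drop-∷ (p + suc c) X after-run) (proj₂ fits))))
    where
    run : drop p X ≡ replicate (suc c) zer ++ num (suc (toℕ j)) ∷ concatMap (cell f) js ++ zer ∷ []
    run = trans eq (replicate-++-∷ c zer _)
    after-run : drop (p + suc c) X ≡ num (suc (toℕ j)) ∷ concatMap (cell f) js ++ zer ∷ []
    after-run = drop-replicate p X (suc c) run
    at-num : X at (p + suc c) ≡ just (num (suc (toℕ j)))
    at-num = drop≡∷⇒at (p + suc c) X after-run

lemma7p7 : (n : ℕ) (f : Fin n → Bool) → (∃ λ j → f j ≡ true) →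
    LZ77Size (buildX n f) (2 * length (S n f) + 4)
lemma7p7 (suc n) f (j , fj) = subst (LZ77Size X) (+-comm 4 (2 * length (S (suc n) f)))
  (step (fresh⇒phraseLen X (at⇒< X (zeros-prefix 0 (s≤s z≤n))) λ _ ())
  (step (run⇒phraseLen X zeros-prefix (s≤s z≤n) 0<ℓ (n≤1+n ℓ) refl dollar-fresh)
  (step (fresh⇒phraseLen X (at⇒< X at-dollar) dollar-fresh)
  (cells⇒LZ77 (allFin (suc n)) (m≤n+m 1 (2 * suc n)) (drop-∷ (2 * suc n) X drop-prefix) fits))))
  where
  open BuildX (suc n) f
  -- 2 * suc n reduces to suc ℓ, so ℓ is 2(n+1) - 1.
  ℓ : ℕ
  ℓ = n + suc (n + 0)
  0<ℓ : 0 < ℓ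
  0<ℓ = ≤-trans (s≤s z≤n) (m≤n+m _ n)
  fits : RunsAtMost (2 * suc n) 0 (allFin (suc n))
  fits = runsAtMost-any 0 (allFin (suc n)) (Any.map (λ { refl → fj }) (∈-allFin j))
                        (≤-reflexive (cong (2 *_) (length-tabulate {n = suc n} (λ i → i))))
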